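{- For any $1\le k\le n$, in F-MMB with $n$ leaves the membership proof of the $k$-th most recently appended item consists of at most $2\lfloor\log_2 k\rfloor+2$ hashes.
   Context: A mountain of height $s\ge0$ is a perfect binary tree with $2^s$ leaves; its root is its peak. The U-MMB with $n$ leaves is an ordered (left-to-right) list of mountains whose leaves read left to right are $h_1,\dots,h_n$, built inductively from the empty list: the $n$-th append (1) adds $h_n$ as a height-0 mountain at the right end, and (2) if there exist two consecutive mountains of equal height, takes the rightmost such pair, of height $s$, and replaces it in place by a mountain of height $s+1$ whose new peak has the two old peaks as children. The F-MMB forward-bags the peaks $P_1,\dots,P_t$ (left to right): range nodes $R_1$ (single child $P_1$) and $R_j$ with children $R_{j-1},P_j$; the root is $R_t$. The membership proof of a leaf is the list of hashes of the siblings of the nodes on the path from the leaf to the root (a node without a sibling contributes no hash). The $k$-th most recent item corresponds to leaf $h_{n-k+1}$. -}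

module Defs where

open import Data.Nat using (ℕ; zero; suc; _∸_; _<?_; _≟_)
open import Data.List using (List; []; _∷_; _++_; [_]; map)
open import Data.Maybe using (Maybe; just; nothing)
open import Data.Product using (_×_; _,_; proj₁; proj₂)
open import Data.Nat using (_+_)
open import Relation.Nullary using (yes; no)

-- Binary trees: leaves, unary nodes (only used for R₁ in the F-MMB), binary nodes.
data Tree : Set where
  leaf  : Tree
  node1 : Tree → Tree
  node2 : Tree → Tree → Tree

leaves : Tree → ℕ
leaves leaf = 1
leaves (node1 t) = leaves t
leaves (node2 l r) = leaves l + leaves r

-- A mountain is stored together with its height.
Mountain : Set
Mountain = ℕ × Tree

mergeRightmost : List Mountain → Maybe (List Mountain)
mergeRightmost [] = nothing
mergeRightmost (x ∷ []) = nothing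
mergeRightmost (x ∷ y ∷ r) with mergeRightmost (y ∷ r)
... | just r' = just (x ∷ r')
... | nothing with proj₁ x ≟ proj₁ y
...   | yes _ = just ((suc (proj₁ x) , node2 (proj₂ x) (proj₂ y)) ∷ r)
...   | no _  = nothing

append : List Mountain → List Mountain
append ms with mergeRightmost (ms ++ [ (0 , leaf) ])
... | just ms' = ms'
... | nothing  = ms ++ [ (0 , leaf) ]

UMMB : ℕ → List Mountain
UMMB zero = []
UMMB (suc n) = append (UMMB n)

bagFrom : Tree → List Tree → Tree
bagFrom R [] = R
bagFrom R (P ∷ Ps) = bagFrom (node2 R P) Ps

bag : List Tree → Maybe Tree
bag [] = nothing
bag (P ∷ Ps) = just (bagFrom (node1 P) Ps)

FMMB : ℕ → Maybe Tree
FMMB n = bag (map proj₂ (UMMB n))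

-- Membership proof of the leaf at 0-based position i (left to right):
-- the siblings (standing for their hashes) of the nodes on the path from
-- that leaf to the root, listed from the leaf upwards; nodes without a
-- sibling contribute nothing. nothing if i is out of range.
membershipProof : Tree → ℕ → Maybe (List Tree)
membershipProof leaf zero = just []
membershipProof leaf (suc i) = nothing
membershipProof (node1 t) i = membershipProof t i
membershipProof (node2 l r) i with i <? leaves l
... | yes _ with membershipProof l i
...   | just p  = just (p ++ [ r ])
...   | nothing = nothing
membershipProof (node2 l r) i | no _ with membershipProof r (i ∸ leaves l)
...   | just p  = just (p ++ [ l ])
...   | nothing = nothing

{-# OPTIONS --safe #-}
module Submission where

-- In the U-MMB a mountain with m mountains to its right has height m or m + 1, an invariant
-- kept by appending a leaf and merging the rightmost pair of equal heights.  The proof of a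
-- leaf in such a mountain consists of at most m + 1 siblings inside it, the range node on its
-- left (none for the first peak) and the m peaks to its right: at most 2m + 2 hashes.  Those
-- m mountains hold at least 2^m − 1 leaves, all more recent, so 2^m ≤ k and m ≤ ⌊log₂ k⌋.

open import Defs
open import Data.Nat using (ℕ; zero; suc; _≤_; _<_; _∸_; _+_; _*_; _^_; _<?_; _≤?_; _≟_; s≤s)
open import Data.Nat.Properties
open import Data.Nat.Logarithm using (⌊log₂_⌋; ⌊log₂⌋-mono-≤; ⌊log₂[2^n]⌋≡n)
open import Data.List using (List; []; _∷_; _++_; [_]; map; length)
open import Data.List.Properties using (length-++; length-map; map-++; ++-assoc; ++-identityʳ)
open import Data.Nat.ListAction using (sum)
open import Data.Nat.ListAction.Properties using (sum-++)
open import Data.Maybe using (Maybe; just; nothing)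
open import Data.Product using (∃-syntax; _×_; _,_; proj₁; proj₂)
open import Data.Empty using (⊥-elim)
open import Function using (_∘_)
open import Relation.Nullary using (Dec; yes; no)
open import Relation.Binary.PropositionalEquality
  using (_≡_; refl; sym; trans; cong; cong₂; subst)

private
  variable
    h m i : ℕ
    l r T R : Tree
    π : List Tree
    ms : List Mountain

m<n+o⇒m∸n<o′ : ∀ {m n o} → n ≤ m → m < n + o → m ∸ n < o
m<n+o⇒m∸n<o′ {m} {n} {o} n≤m m<n+o = subst (m ∸ n <_) (m+n∸m≡n n o) (∸-monoˡ-< m<n+o n≤m)

length-snoc : ∀ {A : Set} (xs : List A) x → length (xs ++ [ x ]) ≡ suc (length xs)
length-snoc xs x = trans (length-++ xs) (+-comm (length xs) 1)

membershipProof-node2ˡ : i < leaves l → membershipProof l i ≡ just π →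
                         membershipProof (node2 l r) i ≡ just (π ++ [ r ])
membershipProof-node2ˡ {i} {l} i<l e with i <? leaves l
... | yes _   rewrite e = refl
... | no i≮l  = ⊥-elim (i≮l i<l)

membershipProof-node2ʳ : leaves l ≤ i → membershipProof r (i ∸ leaves l) ≡ just π →
                         membershipProof (node2 l r) i ≡ just (π ++ [ l ])
membershipProof-node2ʳ {l} {i} l≤i e with i <? leaves l
... | yes i<l = ⊥-elim (<⇒≱ i<l l≤i)
... | no _    rewrite e = refl

membershipProof-bagFrom : ∀ Ps → i < leaves R → membershipProof R i ≡ just π →
                          membershipProof (bagFrom R Ps) i ≡ just (π ++ Ps)
membershipProof-bagFrom {π = π} [] _ e rewrite ++-identityʳ π = e
membershipProof-bagFrom {R = R} {π} (P ∷ Ps) i<R e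
  rewrite sym (++-assoc π [ P ] Ps) =
  membershipProof-bagFrom Ps (≤-trans i<R (m≤m+n (leaves R) (leaves P)))
                          (membershipProof-node2ˡ {l = R} {r = P} i<R e)

data Perfect : ℕ → Tree → Set where
  leaf : Perfect 0 leaf
  node : Perfect h l → Perfect h r → Perfect (suc h) (node2 l r)

leaves-perfect : Perfect h T → leaves T ≡ 2 ^ h
leaves-perfect leaf = refl
leaves-perfect (node {h} pl pr) =
  cong₂ _+_ (leaves-perfect pl) (trans (leaves-perfect pr) (sym (+-identityʳ (2 ^ h))))

membershipProof-perfect : Perfect h T → i < leaves T →
                          ∃[ π ] (membershipProof T i ≡ just π × length π ≡ h)
membershipProof-perfect {i = zero} leaf _ = [] , refl , refl
membershipProof-perfect {i = suc _} leaf (s≤s ())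
membershipProof-perfect {i = i} (node {l = l} {r} pl pr) i<lr with leaves l ≤? i
... | no l≰i =
  let i<l = ≰⇒> l≰i
      π , e , len = membershipProof-perfect pl i<l
  in π ++ [ r ] , membershipProof-node2ˡ {l = l} {r = r} i<l e , trans (length-snoc π r) (cong suc len)
... | yes l≤i =
  let π , e , len = membershipProof-perfect pr (m<n+o⇒m∸n<o′ l≤i i<lr)
  in π ++ [ l ] , membershipProof-node2ʳ {l = l} {r = r} l≤i e , trans (length-snoc π l) (cong suc len)

leafCount : List Mountain → ℕ
leafCount = sum ∘ map (leaves ∘ proj₂)

leafCount-++ : ∀ xs ys → leafCount (xs ++ ys) ≡ leafCount xs + leafCount ys
leafCount-++ xs ys = trans (cong sum (map-++ (leaves ∘ proj₂) xs ys)) (sum-++ (map (leaves ∘ proj₂) xs) _)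

leafCount-mergeRightmost : ∀ L {L′} → mergeRightmost L ≡ just L′ → leafCount L′ ≡ leafCount L
leafCount-mergeRightmost (x ∷ y ∷ rest) e with mergeRightmost (y ∷ rest) in merged
leafCount-mergeRightmost ((_ , T) ∷ y ∷ rest) refl | just _ =
  cong (leaves T +_) (leafCount-mergeRightmost (y ∷ rest) merged)
... | nothing with proj₁ x ≟ proj₁ y
leafCount-mergeRightmost ((_ , T) ∷ (_ , T′) ∷ rest) refl | nothing | yes _ =
  +-assoc (leaves T) (leaves T′) (leafCount rest)

leafCount-snoc : ∀ ms → leafCount (ms ++ [ (0 , leaf) ]) ≡ suc (leafCount ms)
leafCount-snoc ms = trans (leafCount-++ ms _) (+-comm (leafCount ms) 1)

leafCount-append : ∀ ms → leafCount (append ms) ≡ suc (leafCount ms)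
leafCount-append ms with mergeRightmost (ms ++ [ (0 , leaf) ]) in merged
... | just _  = trans (leafCount-mergeRightmost (ms ++ [ (0 , leaf) ]) merged) (leafCount-snoc ms)
... | nothing = leafCount-snoc ms

leafCount-UMMB : ∀ n → leafCount (UMMB n) ≡ n
leafCount-UMMB zero    = refl
leafCount-UMMB (suc n) = trans (leafCount-append (UMMB n)) (cong suc (leafCount-UMMB n))

data Shape (Rel : ℕ → ℕ → Set) : ℕ → List Mountain → Set where
  []  : Shape Rel 0 []
  _∷_ : Rel m h × Perfect h T → Shape Rel m ms → Shape Rel (suc m) ((h , T) ∷ ms)

length-Shape : ∀ {Rel} → Shape Rel m ms → length ms ≡ m
length-Shape []      = refl
length-Shape (_ ∷ s) = cong suc (length-Shape s)

data Slack (m : ℕ) : ℕ → Set where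
  tight : Slack m m
  loose : Slack m (suc m)

Slack-suc : Slack m h → Slack (suc m) (suc h)
Slack-suc tight = tight
Slack-suc loose = loose

Slack-pred : Slack (suc m) (suc h) → Slack m h
Slack-pred tight = tight
Slack-pred loose = loose

Slack⇒≤ : Slack m h → m ≤ h
Slack⇒≤ tight = ≤-refl
Slack⇒≤ loose = n≤1+n _

Slack⇒≤1+ : Slack m h → h ≤ suc m
Slack⇒≤1+ tight = n≤1+n _
Slack⇒≤1+ loose = ≤-refl

Staircase Belt PreBelt : ℕ → List Mountain → Set
Staircase = Shape _≡_
Belt      = Shape Slack
PreBelt   = Shape (λ m h → Slack m (suc h))

staircase⇒belt : Staircase m ms → Belt m ms
staircase⇒belt []                = []
staircase⇒belt ((refl , P) ∷ s) = (tight , P) ∷ staircase⇒belt s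

preBelt-snoc : Belt m ms → PreBelt (suc m) (ms ++ [ (0 , leaf) ])
preBelt-snoc []             = (loose , leaf) ∷ []
preBelt-snoc ((s , P) ∷ b) = (Slack-suc s , P) ∷ preBelt-snoc b

data MergeOutcome (m : ℕ) (L : List Mountain) : Maybe (List Mountain) → Set where
  unmerged : Staircase (suc m) L → MergeOutcome m L nothing
  merged   : ∀ {L′} → Belt m L′ → MergeOutcome m L (just L′)

mergeRightmost-preBelt : ∀ {L} → PreBelt (suc m) L → MergeOutcome m L (mergeRightmost L)
mergeRightmost-preBelt ((loose , P) ∷ []) = unmerged ((refl , P) ∷ [])
mergeRightmost-preBelt {L = (h , T) ∷ (h′ , T′) ∷ rest} ((s , P) ∷ pre@(_ ∷ _))
  with mergeRightmost ((h′ , T′) ∷ rest) | mergeRightmost-preBelt pre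
... | just _  | merged b = merged ((Slack-pred s , P) ∷ b)
... | nothing | unmerged ((refl , P′) ∷ stairs) with h ≟ h′
...   | yes refl = merged ((loose , node P P′) ∷ staircase⇒belt stairs)
...   | no h≢h′ with s
...     | tight = ⊥-elim (h≢h′ refl)
...     | loose = unmerged ((refl , P) ∷ (refl , P′) ∷ stairs)

belt-append : Belt m ms → ∃[ m′ ] Belt m′ (append ms)
belt-append {ms = ms} b with mergeRightmost (ms ++ [ (0 , leaf) ]) | mergeRightmost-preBelt (preBelt-snoc b)
... | just _  | merged b′       = _ , b′
... | nothing | unmerged stairs = _ , staircase⇒belt stairs

belt-UMMB : ∀ n → ∃[ m ] Belt m (UMMB n)
belt-UMMB zero    = 0 , []
belt-UMMB (suc n) = belt-append (proj₂ (belt-UMMB n))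

2^m≤1+leafCount : Belt m ms → 2 ^ m ≤ suc (leafCount ms)
2^m≤1+leafCount []                                = ≤-refl
2^m≤1+leafCount {suc m} (_∷_ {T = T} {ms} (s , P) b) = begin
  2 ^ m + (2 ^ m + 0)             ≡⟨ cong (2 ^ m +_) (+-identityʳ (2 ^ m)) ⟩
  2 ^ m + 2 ^ m                   ≤⟨ +-mono-≤ 2^m≤T (2^m≤1+leafCount b) ⟩
  leaves T + suc (leafCount ms)  ≡⟨ +-suc (leaves T) (leafCount ms) ⟩
  suc (leaves T + leafCount ms)  ∎
  where
  open ≤-Reasoning
  2^m≤T : 2 ^ m ≤ leaves T
  2^m≤T = ≤-trans (^-monoʳ-≤ 2 (Slack⇒≤ s)) (≤-reflexive (sym (leaves-perfect P)))

2^m≤n⇒m≤⌊log₂n⌋ : ∀ {n} → 2 ^ m ≤ n → m ≤ ⌊log₂ n ⌋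
2^m≤n⇒m≤⌊log₂n⌋ {m} 2^m≤n = subst (_≤ _) (⌊log₂[2^n]⌋≡n m) (⌊log₂⌋-mono-≤ 2^m≤n)

ShortProof : Tree → ℕ → ℕ → Set
ShortProof t i k = ∃[ π ] (membershipProof t i ≡ just π × length π ≤ 2 * ⌊log₂ k ⌋ + 2)

m<n∧m+[1+o]≡n+p⇒p≤o : ∀ {m n o p} → m < n → m + suc o ≡ n + p → p ≤ o
m<n∧m+[1+o]≡n+p⇒p≤o {m} {n} {o} {p} m<n eq = +-cancelˡ-≤ n p o (begin
  n + p      ≡⟨ sym eq ⟩
  m + suc o  ≡⟨ +-suc m o ⟩
  suc m + o  ≤⟨ +-monoˡ-≤ o m<n ⟩
  n + o      ∎)
  where open ≤-Reasoning

shortProof-bagFrom-within : ∀ {k} → Belt m ms → i < leaves R → i + suc k ≡ leaves R + leafCount ms →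
                     membershipProof R i ≡ just π → length π ≤ 2 + m →
                     ShortProof (bagFrom R (map proj₂ ms)) i (suc k)
shortProof-bagFrom-within {m} {ms} {π = π} {k} b i<R eq e |π|≤2+m =
  π ++ map proj₂ ms , membershipProof-bagFrom (map proj₂ ms) i<R e , (begin
    length (π ++ map proj₂ ms)  ≡⟨ trans (length-++ π) (cong (length π +_) |ms|≡m) ⟩
    length π + m                ≤⟨ +-monoˡ-≤ m |π|≤2+m ⟩
    2 + m + m                   ≡⟨ cong (λ x → 2 + (m + x)) (sym (+-identityʳ m)) ⟩
    2 + 2 * m                   ≡⟨ +-comm 2 (2 * m) ⟩
    2 * m + 2                   ≤⟨ +-monoˡ-≤ 2 (*-monoʳ-≤ 2 m≤log) ⟩
    2 * ⌊log₂ suc k ⌋ + 2       ∎)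
  where
  open ≤-Reasoning
  |ms|≡m : length (map proj₂ ms) ≡ m
  |ms|≡m = trans (length-map proj₂ ms) (length-Shape b)
  m≤log : m ≤ ⌊log₂ suc k ⌋
  m≤log = 2^m≤n⇒m≤⌊log₂n⌋ (≤-trans (2^m≤1+leafCount b) (s≤s (m<n∧m+[1+o]≡n+p⇒p≤o i<R eq)))

shortProof-bagFrom-beyond : ∀ {k} → Belt m ms → leaves R ≤ i → i + suc k ≡ leaves R + leafCount ms →
                            ShortProof (bagFrom R (map proj₂ ms)) i (suc k)
shortProof-bagFrom-beyond {R = R} {i} [] R≤i eq =
  ⊥-elim (m+1+n≰m i (≤-trans (≤-reflexive (trans eq (+-identityʳ (leaves R)))) R≤i))
shortProof-bagFrom-beyond {R = R} {i} {k} (_∷_ {T = T} {ms} (s , P) b) R≤i eq =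
  split (leaves R + leaves T ≤? i)
  where
  eq′ : i + suc k ≡ leaves (node2 R T) + leafCount ms
  eq′ = trans eq (sym (+-assoc (leaves R) (leaves T) (leafCount ms)))
  split : Dec (leaves R + leaves T ≤ i) → ShortProof (bagFrom (node2 R T) (map proj₂ ms)) i (suc k)
  split (yes RT≤i) = shortProof-bagFrom-beyond b RT≤i eq′
  split (no RT≰i)  =
    let π , e , |π|≡h = membershipProof-perfect P (m<n+o⇒m∸n<o′ R≤i (≰⇒> RT≰i))
        |π++R|≡1+h   = trans (length-snoc π R) (cong suc |π|≡h)
    in shortProof-bagFrom-within b (≰⇒> RT≰i) eq′ (membershipProof-node2ʳ {l = R} {r = T} R≤i e)
         (≤-trans (≤-reflexive |π++R|≡1+h) (s≤s (Slack⇒≤1+ s)))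

shortProof-bag : ∀ {k} → Belt m ms → i + suc k ≡ leafCount ms →
                 ∃[ t ] (bag (map proj₂ ms) ≡ just t × ShortProof t i (suc k))
shortProof-bag {i = i} [] eq = ⊥-elim (m+1+n≢0 i eq)
shortProof-bag {i = i} {k} (_∷_ {T = T} {ms} (s , P) b) eq = _ , refl , split (leaves T ≤? i)
  where
  split : Dec (leaves T ≤ i) → ShortProof (bagFrom (node1 T) (map proj₂ ms)) i (suc k)
  split (yes T≤i) = shortProof-bagFrom-beyond b T≤i eq
  split (no T≰i)  =
    let π , e , |π|≡h = membershipProof-perfect P (≰⇒> T≰i)
    in shortProof-bagFrom-within b (≰⇒> T≰i) eq e
         (≤-trans (≤-reflexive |π|≡h) (≤-trans (Slack⇒≤1+ s) (n≤1+n _)))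

lemma11 : ∀ (n k : ℕ) → 1 ≤ k → k ≤ n →
    ∃[ t ] (FMMB n ≡ just t ×
      ∃[ π ] (membershipProof t (n ∸ k) ≡ just π ×
        length π ≤ 2 * ⌊log₂ k ⌋ + 2))
lemma11 n (suc k) _ k≤n =
  shortProof-bag (proj₂ (belt-UMMB n)) (trans (m∸n+n≡m k≤n) (sym (leafCount-UMMB n)))
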